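{- Let $P$ be a poset, $A\subseteq P$ and $\prec$ an approximating auxiliary relation on $P$. Then \[\operatorname{int}_\sigma(A)\subseteq\operatorname{int}_{\mu^\prec}(A)\subseteq A^{\downarrow\prec}\subseteq A\subseteq A^{\uparrow\prec}\subseteq\operatorname{cl}_{\mu^\prec}(A)\subseteq\operatorname{cl}_\sigma(A).\]
   Context: For a poset $(P,\le)$, $\mathord{\downarrow}X=\{x\mid\exists y\in X,\ x\le y\}$, $\mathord{\uparrow}X$ dually. A subset is directed if nonempty and every finite subset has an upper bound in it. An auxiliary relation on $P$ is a binary relation $\prec$ such that: $x\prec y$ implies $x\le y$; $u\le x\prec y\le z$ implies $u\prec z$; if $P$ has a least element $\bot$ then $\bot\prec x$ for all $x$. Write $s_\prec(x)=\{y\mid y\prec x\}$; $\prec$ is approximating if every $s_\prec(x)$ is directed with $\bigvee s_\prec(x)=x$. $A^{\downarrow\prec}=\{x\in A\mid s_\prec(x)\cap A\ne\emptyset\}$, $A^{\uparrow\prec}=\{x\in P\mid s_\prec(x)\subseteq\mathord{\downarrow}A\}$. $U$ is $\prec$-open if $U=\mathord{\uparrow}U$ and $U=U^{\downarrow\prec}$; these form a topology $\mu^\prec(P)$ with interior/closure $\operatorname{int}_{\mu^\prec}$, $\operatorname{cl}_{\mu^\prec}$. Scott open sets: upper sets $U$ such that whenever $D$ is directed with $\bigvee D$ existing and in $U$, $D\cap U\neq\emptyset$; $\operatorname{int}_\sigma,\operatorname{cl}_\sigma$ are Scott interior and closure. -}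

module Defs where

open import Level using (Level; _⊔_) renaming (suc to lsuc)
open import Data.Product using (Σ; ∃; _×_; _,_)
open import Relation.Unary using (Pred; _∈_; _⊆_)
open import Relation.Binary using (Rel)
open import Relation.Binary.Bundles using (Poset)

-- Throughout, all data (carrier, equality, order, auxiliary relation,
-- subsets, and the subsets quantified over in the definitions of the
-- topologies) live in a single universe level ℓ.
module PosetNotions {ℓ : Level} (P : Poset ℓ ℓ ℓ) where
  open Poset P renaming (Carrier to C)

  ↓ : Pred C ℓ → Pred C ℓ
  ↓ X x = ∃ λ y → y ∈ X × x ≤ y

  ↑ : Pred C ℓ → Pred C ℓ
  ↑ X x = ∃ λ y → y ∈ X × y ≤ x

  Directed : Pred C ℓ → Set ℓ
  Directed D = (∃ λ d → d ∈ D)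
             × (∀ x y → x ∈ D → y ∈ D → ∃ λ z → z ∈ D × x ≤ z × y ≤ z)

  IsJoin : Pred C ℓ → C → Set ℓ
  IsJoin D s = (∀ d → d ∈ D → d ≤ s) × (∀ u → (∀ d → d ∈ D → d ≤ u) → s ≤ u)

  IsLeast : C → Set ℓ
  IsLeast b = ∀ y → b ≤ y

  record IsAuxiliary (_≺_ : Rel C ℓ) : Set ℓ where
    field
      ≺⇒≤   : ∀ {x y} → x ≺ y → x ≤ y
      ≤≺≤⇒≺ : ∀ {u x y z} → u ≤ x → x ≺ y → y ≤ z → u ≺ z
      ⊥≺    : ∀ b → IsLeast b → ∀ x → b ≺ x

  s≺ : Rel C ℓ → C → Pred C ℓ
  s≺ _≺_ x y = y ≺ x

  IsApproximating : Rel C ℓ → Set ℓ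
  IsApproximating _≺_ = ∀ x → Directed (s≺ _≺_ x) × IsJoin (s≺ _≺_ x) x

  _^↓≺_ : Pred C ℓ → Rel C ℓ → Pred C ℓ
  (A ^↓≺ _≺_) x = x ∈ A × (∃ λ y → y ≺ x × y ∈ A)

  _^↑≺_ : Pred C ℓ → Rel C ℓ → Pred C ℓ
  (A ^↑≺ _≺_) x = s≺ _≺_ x ⊆ ↓ A

  _≐_ : Pred C ℓ → Pred C ℓ → Set ℓ
  X ≐ Y = X ⊆ Y × Y ⊆ X

  IsOpen≺ : Rel C ℓ → Pred C ℓ → Set ℓ
  IsOpen≺ _≺_ U = (U ≐ ↑ U) × (U ≐ (U ^↓≺ _≺_))

  IsScottOpen : Pred C ℓ → Set (lsuc ℓ)
  IsScottOpen U = (U ≐ ↑ U)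
    × (∀ (D : Pred C ℓ) → Directed D → ∀ s → IsJoin D s → s ∈ U
         → ∃ λ d → d ∈ D × d ∈ U)

  Interior : (Pred C ℓ → Set (lsuc ℓ)) → Pred C ℓ → Pred C (lsuc ℓ)
  Interior Open A x = Σ (Pred C ℓ) λ U → Open U × U ⊆ A × x ∈ U

  Closure : (Pred C ℓ → Set (lsuc ℓ)) → Pred C ℓ → Pred C (lsuc ℓ)
  Closure Open A x = ∀ (U : Pred C ℓ) → Open U → x ∈ U → ∃ λ a → a ∈ U × a ∈ A

  OpenMu : Rel C ℓ → Pred C ℓ → Set (lsuc ℓ)
  OpenMu _≺_ U = Level.Lift (lsuc ℓ) (IsOpen≺ _≺_ U)

  int-σ cl-σ : Pred C ℓ → Pred C (lsuc ℓ)
  int-σ = Interior IsScottOpen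
  cl-σ  = Closure IsScottOpen

  int-μ cl-μ : Rel C ℓ → Pred C ℓ → Pred C (lsuc ℓ)
  int-μ _≺_ = Interior (OpenMu _≺_)
  cl-μ  _≺_ = Closure (OpenMu _≺_)

-- Every Scott open set is ≺-open: if x ∈ U then x is the directed join of
-- s≺ x, so s≺ x meets U. Hence μ≺ is coarser than σ, which gives the two
-- outer inclusions; the inner ones unfold the definitions, using that a
-- μ≺-open neighbourhood of x contains some y ≺ x and is an upper set.
module Submission where

open import Defs
open import Level using (Level; lift)
open import Data.Product using (∃; _×_; _,_; proj₁; proj₂)
open import Relation.Unary using (Pred; _∈_; _⊆_)
open import Relation.Binary using (Rel)
open import Relation.Binary.Bundles using (Poset)

module _ {ℓ : Level} (P : Poset ℓ ℓ ℓ) where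
  open Poset P renaming (Carrier to C)
  open PosetNotions P

  Interior-mono : ∀ {Open₁ Open₂ : Pred C ℓ → Set (Level.suc ℓ)} →
    (∀ U → Open₁ U → Open₂ U) → ∀ A → Interior Open₁ A ⊆ Interior Open₂ A
  Interior-mono open₁⇒open₂ A (U , U-open , U⊆A , x∈U) =
    U , open₁⇒open₂ U U-open , U⊆A , x∈U

  Closure-antitone : ∀ {Open₁ Open₂ : Pred C ℓ → Set (Level.suc ℓ)} →
    (∀ U → Open₁ U → Open₂ U) → ∀ A → Closure Open₂ A ⊆ Closure Open₁ A
  Closure-antitone open₁⇒open₂ A x∈cl U U-open = x∈cl U (open₁⇒open₂ U U-open)

  module _ (_≺_ : Rel C ℓ) where

    scottOpen⇒open≺ : IsApproximating _≺_ → ∀ U → IsScottOpen U → IsOpen≺ _≺_ U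
    scottOpen⇒open≺ approx U (U-upper , U-inaccessible) =
      U-upper , (λ x∈U → x∈U , meets-s≺ x∈U) , proj₁
      where
      meets-s≺ : ∀ {x} → x ∈ U → ∃ λ y → y ≺ x × y ∈ U
      meets-s≺ {x} = U-inaccessible (s≺ _≺_ x) (proj₁ (approx x)) x (proj₂ (approx x))

    int-σ⊆int-μ : IsApproximating _≺_ → ∀ A → int-σ A ⊆ int-μ _≺_ A
    int-σ⊆int-μ approx = Interior-mono λ U U-open → lift (scottOpen⇒open≺ approx U U-open)

    cl-μ⊆cl-σ : IsApproximating _≺_ → ∀ A → cl-μ _≺_ A ⊆ cl-σ A
    cl-μ⊆cl-σ approx = Closure-antitone λ U U-open → lift (scottOpen⇒open≺ approx U U-open)

    int-μ⊆^↓≺ : ∀ A → int-μ _≺_ A ⊆ (A ^↓≺ _≺_)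
    int-μ⊆^↓≺ A (U , lift (_ , U⊆U^↓≺ , _) , U⊆A , x∈U) with U⊆U^↓≺ x∈U
    ... | _ , y , y≺x , y∈U = U⊆A x∈U , y , y≺x , U⊆A y∈U

    ⊆^↑≺ : (∀ {x y} → x ≺ y → x ≤ y) → ∀ A → A ⊆ (A ^↑≺ _≺_)
    ⊆^↑≺ ≺⇒≤ A {x} x∈A y≺x = x , x∈A , ≺⇒≤ y≺x

    ^↑≺⊆cl-μ : ∀ A → (A ^↑≺ _≺_) ⊆ cl-μ _≺_ A
    ^↑≺⊆cl-μ A s≺x⊆↓A U (lift ((_ , ↑U⊆U) , U⊆U^↓≺ , _)) x∈U with U⊆U^↓≺ x∈U
    ... | _ , y , y≺x , y∈U with s≺x⊆↓A y≺x
    ...   | a , a∈A , y≤a = a , ↑U⊆U (y , y∈U , y≤a) , a∈A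

theorem3p24 : ∀ {ℓ : Level} (P : Poset ℓ ℓ ℓ) → let open PosetNotions P in
    (_≺_ : Rel (Poset.Carrier P) ℓ) → IsAuxiliary _≺_ → IsApproximating _≺_ →
    (A : Pred (Poset.Carrier P) ℓ) →
    (int-σ A ⊆ int-μ _≺_ A)
    × (int-μ _≺_ A ⊆ (A ^↓≺ _≺_))
    × ((A ^↓≺ _≺_) ⊆ A)
    × (A ⊆ (A ^↑≺ _≺_))
    × ((A ^↑≺ _≺_) ⊆ cl-μ _≺_ A)
    × (cl-μ _≺_ A ⊆ cl-σ A)
theorem3p24 P _≺_ aux approx A =
    int-σ⊆int-μ P _≺_ approx A
  , int-μ⊆^↓≺ P _≺_ A
  , proj₁
  , ⊆^↑≺ P _≺_ (PosetNotions.IsAuxiliary.≺⇒≤ aux) A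
  , ^↑≺⊆cl-μ P _≺_ A
  , cl-μ⊆cl-σ P _≺_ approx A
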